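{- Let $w\in D_{k+1,n}$ and let $\Delta_{(w)}\subseteq\Delta_{k+1,n}$ be its $w$-simplex, with vertex sets $I_a$ as below. Then: (1) for all $a\ne b$ in $[n]$, every point $x\in\Delta_{(w)}$ satisfies $|I_b\cap[a,b-1]|\le x_{[a,b-1]}\le |I_a\cap[a,b-1]|$; (2) a minimal inequality description of $\Delta_{(w)}$ as a subset of $\mathbb R^n$ is given by the equation $x_{[n]}=k+1$ together with the $n$ facet inequalities $|I_b\cap[a,b-1]|\le x_{[a,b-1]}$, one for each pair $(a,b)$ such that $a$ immediately precedes $b$ in the cycle $(w)$.
   Context: Notation: $x_S=\sum_{i\in S}x_i$ for $x\in\mathbb R^n$; $[a,b]=\{a,a+1,\dots,b\}$ cyclically mod $n$; $e_I=\sum_{i\in I}e_i$; $\Delta_{k+1,n}=\mathrm{conv}\{e_I:|I|=k+1\}$. For $w=w_1\cdots w_n\in S_n$, $i\in[n]$ is a cyclic descent of $w$ if either $i<n$ and $i$ occurs to the right of $i+1$ in $w$, or $i=n$ and $1$ occurs to the left of $n$ in $w$; $\mathrm{cdes}(w)$ is the set of cyclic descents. $D_{k+1,n}$ is the set of $w\in S_n$ with $w_n=n$ and exactly $k+1$ cyclic descents. For $a\in[n]$, $w^{(a)}$ is the cyclic rotation of the word $w$ ending with $a$, and $I_a=\mathrm{cdes}(w^{(a)})$. The $w$-simplex is $\Delta_{(w)}=\mathrm{conv}(e_{I_1},\dots,e_{I_n})$. $(w)$ is the $n$-cycle $w_1\mapsto w_2\mapsto\cdots\mapsto w_n\mapsto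 w_1$; $a$ immediately precedes $b$ in $(w)$ if $(w)$ sends $a$ to $b$.
   Formalization: Points x have rational coordinates, lying in ℚ^n instead of ℝ^n, and the convex combinations forming $\Delta_{(w)}$ use rational weights. -}

module Defs where

open import Data.Nat as ℕ using (ℕ; zero; suc; _∸_; _<ᵇ_; _≤ᵇ_)
open import Data.Nat.Properties using () renaming (_<?_ to _<ℕ?_)
open import Data.Bool using (Bool; true; false; if_then_else_)
open import Data.Fin using (Fin; zero; suc; toℕ; fromℕ<)
open import Data.Fin.Permutation using (Permutation′; _⟨$⟩ʳ_; _⟨$⟩ˡ_)
open import Data.Integer using (+_)
open import Data.Rational using (ℚ; 0ℚ; 1ℚ; _+_; _*_; _/_; _≤_)
open import Data.Product using (Σ; _×_; ∃)
open import Relation.Nullary using (yes; no)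
open import Relation.Binary.PropositionalEquality using (_≡_)

-- Elements of [n] = {1,…,n} are represented by Fin n (value i ↔ i+1).
-- A permutation w ∈ S_n is a Permutation′ n; w ⟨$⟩ʳ p is the letter at
-- position p (0-indexed), w ⟨$⟩ˡ v is the position of letter v.

cycSuc : ∀ {n} → Fin n → Fin n
cycSuc {suc m} i with suc (toℕ i) <ℕ? suc m
... | yes p = fromℕ< p
... | no _  = zero

sumℚ : ∀ {n} → (Fin n → ℚ) → ℚ
sumℚ {zero}  f = 0ℚ
sumℚ {suc n} f = f zero + sumℚ (λ i → f (suc i))

count : ∀ {n} → (Fin n → Bool) → ℕ
count {zero}  f = 0
count {suc n} f = (if f zero then 1 else 0) ℕ.+ count (λ i → f (suc i))

toℚ : ℕ → ℚ
toℚ m = + m / 1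

pos : ∀ {n} → Permutation′ n → Fin n → ℕ
pos w v = toℕ (w ⟨$⟩ˡ v)

cdes : ∀ {n} → Permutation′ n → Fin n → Bool
cdes w i = pos w (cycSuc i) <ᵇ pos w i

-- D_{k+1,n}: w_n = n and exactly k+1 cyclic descents
InD : (k n : ℕ) → Permutation′ n → Set
InD k n w =
  (∀ (p : Fin n) → toℕ p ≡ n ∸ 1 → toℕ (w ⟨$⟩ʳ p) ≡ n ∸ 1)
  × count (cdes w) ≡ suc k

-- position of letter v in the rotation w^{(a)} (the rotation of the word
-- w ending with a): positions after pos(a) come first, in order.
rotPos : ∀ {n} → Permutation′ n → Fin n → Fin n → ℕ
rotPos {n} w a v =
  if pos w a <ᵇ pos w v then pos w v ∸ suc (pos w a)
  else (pos w v ℕ.+ n) ∸ suc (pos w a)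

-- I_a = cdes(w^{(a)}), as an indicator function
I : ∀ {n} → Permutation′ n → Fin n → Fin n → Bool
I w a i = rotPos w a (cycSuc i) <ᵇ rotPos w a i

eI : ∀ {n} → Permutation′ n → Fin n → Fin n → ℚ
eI w a i = if I w a i then 1ℚ else 0ℚ

InSimplex : ∀ {n} → Permutation′ n → (Fin n → ℚ) → Set
InSimplex {n} w x =
  Σ (Fin n → ℚ) λ t →
    (∀ a → 0ℚ ≤ t a) × sumℚ t ≡ 1ℚ × (∀ i → x i ≡ sumℚ (λ a → t a * eI w a i))

cdist : ∀ {n} → Fin n → Fin n → ℕ
cdist {n} a v = if toℕ a ≤ᵇ toℕ v then toℕ v ∸ toℕ a else (toℕ v ℕ.+ n) ∸ toℕ a

inInt : ∀ {n} → Fin n → Fin n → Fin n → Bool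
inInt a b v = cdist a v <ᵇ cdist a b

xInt : ∀ {n} → Fin n → Fin n → (Fin n → ℚ) → ℚ
xInt a b x = sumℚ (λ v → if inInt a b v then x v else 0ℚ)

cardI∩ : ∀ {n} → Permutation′ n → Fin n → Fin n → Fin n → ℕ
cardI∩ w c a b = count (λ v → if I w c v then inInt a b v else false)

Precedes : ∀ {n} → Permutation′ n → Fin n → Fin n → Set
Precedes w a b = w ⟨$⟩ʳ cycSuc (w ⟨$⟩ˡ a) ≡ b

FacetIneq : ∀ {n} → Permutation′ n → Fin n → Fin n → (Fin n → ℚ) → Set
FacetIneq w a b x = toℚ (cardI∩ w b a b) ≤ xInt a b x

Eqn : ∀ {n} → ℕ → (Fin n → ℚ) → Set
Eqn k x = sumℚ x ≡ toℚ (suc k)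

-- Write [i ≼ c] for "i occurs at or before c in w". Rotating w to end at c changes the
-- descent status of i exactly when [i ≼ c] ≠ [i+1 ≼ c], so e_{I_c} is e_{cdes w} plus the
-- cyclic difference i ↦ [i ≼ c] - [i+1 ≼ c]. Summed over a cyclic interval this
-- telescopes: |I_c ∩ [a,b-1]| = x_{[a,b-1]}(e_{cdes w}) + [a ≼ c] - [b ≼ c], which is
-- smallest at c = b and largest at c = a, and the bounds (1) follow by convexity. When a
-- immediately precedes b in (w), the same formula shows that e_{I_c} exceeds the facet
-- bound of a by exactly [c = a]. Hence on the hyperplane x_{[n]} = k+1 the facet slacks
-- are barycentric coordinates (summation by parts along the positions of w shows that
-- they sum to 1 and reproduce x), and the points 2e_{I_b} - e_{I_a} and 2e_{I_c} show
-- that no facet and not the equation is redundant.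
module Submission where

open import Defs
open import Algebra.Bundles using (Ring)
import Algebra.Properties.Semiring.Sum as SemiringSum
open import Data.Bool using (Bool; true; false; if_then_else_; T)
open import Data.Empty using (⊥-elim)
open import Data.Fin using (Fin; zero; suc; toℕ; fromℕ; inject₁)
import Data.Fin.Properties as Fin
open import Data.Fin.Permutation using (Permutation′; _⟨$⟩ʳ_; _⟨$⟩ˡ_; inverseˡ; inverseʳ)
import Data.Integer as ℤ
import Data.Integer.Properties as ℤ
open import Data.Nat as ℕ using (ℕ; zero; suc; _∸_; _<ᵇ_; _≤ᵇ_; _≡ᵇ_)
import Data.Nat.Coprimality as Coprimality
import Data.Nat.Properties as ℕ
open import Data.Product using (_×_; _,_; proj₁; ∃)
open import Data.Rational using (ℚ; mkℚ; 0ℚ; 1ℚ; _+_; _*_; _-_; -_; _≤_; _<_; _/_; nonNegative)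
open import Data.Rational.Properties
open import Data.Sum using (inj₁; inj₂)
open import Function using (_∘_)
open import Level using (0ℓ)
open import Relation.Binary.Definitions using (tri<; tri≈; tri>)
open import Relation.Binary.PropositionalEquality
open import Relation.Nullary using (¬_; yes; no; contradiction)
open import Relation.Nullary.Decidable using (dec⇒maybe)
open import Relation.Nullary.Reflects using (Reflects; ofʸ; ofⁿ; det; fromEquivalence)
open import Tactic.RingSolver using (solve-∀)
open import Tactic.RingSolver.Core.AlmostCommutativeRing
  using (AlmostCommutativeRing; fromCommutativeRing)

open SemiringSum (Ring.semiring +-*-ring)
  using ( sum; sum-cong-≗; sum-replicate-zero; sum-init-last
        ; ∑-distrib-+; ∑-comm; ∑-permute; *-distribˡ-sum)

ℚ-ring : AlmostCommutativeRing 0ℓ 0ℓ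
ℚ-ring = fromCommutativeRing +-*-commutativeRing (λ x → dec⇒maybe (0ℚ ≟ x))

-- Indicators of comparisons of natural numbers

≡ᵇ-reflects-≡ : ∀ m n → Reflects (m ≡ n) (m ≡ᵇ n)
≡ᵇ-reflects-≡ m n = fromEquivalence (ℕ.≡ᵇ⇒≡ m n) (ℕ.≡⇒≡ᵇ m n)

<ᵇ-true : ∀ {m n} → m ℕ.< n → (m <ᵇ n) ≡ true
<ᵇ-true {m} {n} m<n = det (ℕ.<ᵇ-reflects-< m n) (ofʸ m<n)

<ᵇ-false : ∀ {m n} → n ℕ.≤ m → (m <ᵇ n) ≡ false
<ᵇ-false {m} {n} n≤m = det (ℕ.<ᵇ-reflects-< m n) (ofⁿ (ℕ.≤⇒≯ n≤m))

≤ᵇ-true : ∀ {m n} → m ℕ.≤ n → (m ≤ᵇ n) ≡ true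
≤ᵇ-true {m} {n} m≤n = det (ℕ.≤ᵇ-reflects-≤ m n) (ofʸ m≤n)

≤ᵇ-false : ∀ {m n} → n ℕ.< m → (m ≤ᵇ n) ≡ false
≤ᵇ-false {m} {n} n<m = det (ℕ.≤ᵇ-reflects-≤ m n) (ofⁿ (ℕ.<⇒≱ n<m))

≡ᵇ-true : ∀ {m n} → m ≡ n → (m ≡ᵇ n) ≡ true
≡ᵇ-true {m} {n} m≡n = det (≡ᵇ-reflects-≡ m n) (ofʸ m≡n)

≡ᵇ-false : ∀ {m n} → m ≢ n → (m ≡ᵇ n) ≡ false
≡ᵇ-false {m} {n} m≢n = det (≡ᵇ-reflects-≡ m n) (ofⁿ m≢n)

<ᵇ-+ˡ : ∀ k {x y} → (k ℕ.+ x <ᵇ k ℕ.+ y) ≡ (x <ᵇ y)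
<ᵇ-+ˡ zero    = refl
<ᵇ-+ˡ (suc k) = <ᵇ-+ˡ k

<ᵇ-+ʳ : ∀ k {x y} → (x ℕ.+ k <ᵇ y ℕ.+ k) ≡ (x <ᵇ y)
<ᵇ-+ʳ k {x} {y} = trans (cong₂ _<ᵇ_ (ℕ.+-comm x k) (ℕ.+-comm y k)) (<ᵇ-+ˡ k)

<ᵇ-∸ʳ : ∀ {a x y} → a ℕ.≤ x → a ℕ.≤ y → (x ∸ a <ᵇ y ∸ a) ≡ (x <ᵇ y)
<ᵇ-∸ʳ {a} a≤x a≤y = trans (sym (<ᵇ-+ˡ a)) (cong₂ _<ᵇ_ (ℕ.m+[n∸m]≡n a≤x) (ℕ.m+[n∸m]≡n a≤y))

<ᵇ-suc : ∀ q c → (q <ᵇ suc c) ≡ (q ≤ᵇ c)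
<ᵇ-suc zero    c = refl
<ᵇ-suc (suc q) c = refl

𝟙 : Bool → ℚ
𝟙 b = if b then 1ℚ else 0ℚ

𝟙-nonneg : ∀ b → 0ℚ ≤ 𝟙 b
𝟙-nonneg true  = ≤ᵇ⇒≤ _
𝟙-nonneg false = ≤-refl

if-then-0≡𝟙* : ∀ b q → (if b then q else 0ℚ) ≡ 𝟙 b * q
if-then-0≡𝟙* true  q = sym (*-identityˡ q)
if-then-0≡𝟙* false q = sym (*-zeroˡ q)

𝟙-<ᵇ-complement : ∀ x y → 𝟙 (y <ᵇ x) ≡ 1ℚ - 𝟙 (x ≤ᵇ y)
𝟙-<ᵇ-complement x y with ℕ.≤-<-connex x y
... | inj₁ x≤y rewrite ≤ᵇ-true x≤y | <ᵇ-false x≤y = refl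
... | inj₂ y<x rewrite ≤ᵇ-false y<x | <ᵇ-true y<x = refl

𝟙-transitive : ∀ b₁ b₂ b₃ → (T b₁ → T b₂ → T b₃) → 𝟙 b₁ + 𝟙 b₂ ≤ 1ℚ + 𝟙 b₃
𝟙-transitive true  true  true  _     = ≤ᵇ⇒≤ _
𝟙-transitive true  true  false t     = ⊥-elim (t _ _)
𝟙-transitive true  false true  _     = ≤ᵇ⇒≤ _
𝟙-transitive true  false false _     = ≤ᵇ⇒≤ _
𝟙-transitive false true  true  _     = ≤ᵇ⇒≤ _
𝟙-transitive false true  false _     = ≤ᵇ⇒≤ _
𝟙-transitive false false true  _     = ≤ᵇ⇒≤ _
𝟙-transitive false false false _     = ≤ᵇ⇒≤ _

𝟙-≤ᵇ-trans : ∀ x y z → 𝟙 (x ≤ᵇ y) + 𝟙 (y ≤ᵇ z) ≤ 1ℚ + 𝟙 (x ≤ᵇ z)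
𝟙-≤ᵇ-trans x y z = 𝟙-transitive _ _ _ λ x≤y y≤z →
  ℕ.≤⇒≤ᵇ (ℕ.≤-trans (ℕ.≤ᵇ⇒≤ x y x≤y) (ℕ.≤ᵇ⇒≤ y z y≤z))

-- cdist a v is cycDist n (toℕ a) (toℕ v), and rotPos w c v is
-- cycDist n (suc (pos w c)) (pos w v), both definitionally.
cycDist : ℕ → ℕ → ℕ → ℕ
cycDist n a v = if a ≤ᵇ v then v ∸ a else (v ℕ.+ n) ∸ a

𝟙-cycDist-< : ∀ {n a b v} → a ℕ.≤ n → b ℕ.< n → v ℕ.< n →
  𝟙 (cycDist n a v <ᵇ cycDist n a b) ≡ 𝟙 (a ≤ᵇ v) - 𝟙 (b ≤ᵇ v) + 𝟙 (b <ᵇ a)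
𝟙-cycDist-< {n} {a} {b} {v} a≤n b<n v<n with ℕ.≤-<-connex a v | ℕ.≤-<-connex a b
... | inj₁ a≤v | inj₁ a≤b
  rewrite ≤ᵇ-true a≤v | ≤ᵇ-true a≤b | <ᵇ-false a≤b | <ᵇ-∸ʳ a≤v a≤b
  = trans (𝟙-<ᵇ-complement b v) (sym (+-identityʳ _))
... | inj₁ a≤v | inj₂ b<a
  rewrite ≤ᵇ-true a≤v | ≤ᵇ-false b<a | <ᵇ-true b<a
        | <ᵇ-∸ʳ a≤v (ℕ.≤-trans a≤n (ℕ.m≤n+m n b)) | <ᵇ-true (ℕ.<-≤-trans v<n (ℕ.m≤n+m n b))
        | ≤ᵇ-true (ℕ.<⇒≤ (ℕ.<-≤-trans b<a a≤v))
  = refl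
... | inj₂ v<a | inj₁ a≤b
  rewrite ≤ᵇ-false v<a | ≤ᵇ-true a≤b | <ᵇ-false a≤b
        | <ᵇ-∸ʳ (ℕ.≤-trans a≤n (ℕ.m≤n+m n v)) a≤b | <ᵇ-false (ℕ.≤-trans (ℕ.<⇒≤ b<n) (ℕ.m≤n+m n v))
        | ≤ᵇ-false (ℕ.<-≤-trans v<a a≤b)
  = refl
... | inj₂ v<a | inj₂ b<a
  rewrite ≤ᵇ-false v<a | ≤ᵇ-false b<a | <ᵇ-true b<a
        | <ᵇ-∸ʳ (ℕ.≤-trans a≤n (ℕ.m≤n+m n v)) (ℕ.≤-trans a≤n (ℕ.m≤n+m n b)) | <ᵇ-+ʳ n {v} {b}
  = trans (𝟙-<ᵇ-complement b v) (shift (𝟙 (b ≤ᵇ v)))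
  where
  shift : ∀ X → 1ℚ - X ≡ 0ℚ - X + 1ℚ
  shift = solve-∀ ℚ-ring

𝟙-rotation-< : ∀ {n c p q} → c ℕ.< n → p ℕ.< n → q ℕ.< n →
  𝟙 (cycDist n (suc c) p <ᵇ cycDist n (suc c) q) ≡ 𝟙 (p <ᵇ q) + 𝟙 (q ≤ᵇ c) - 𝟙 (p ≤ᵇ c)
𝟙-rotation-< {n} {c} {p} {q} c<n p<n q<n = begin
  𝟙 (cycDist n (suc c) p <ᵇ cycDist n (suc c) q)
    ≡⟨ 𝟙-cycDist-< c<n q<n p<n ⟩
  𝟙 (c <ᵇ p) - 𝟙 (q ≤ᵇ p) + 𝟙 (q <ᵇ suc c)
    ≡⟨ cong₂ (λ u v → u - 𝟙 (q ≤ᵇ p) + v) (𝟙-<ᵇ-complement p c) (cong 𝟙 (<ᵇ-suc q c)) ⟩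
  (1ℚ - 𝟙 (p ≤ᵇ c)) - 𝟙 (q ≤ᵇ p) + 𝟙 (q ≤ᵇ c)
    ≡⟨ regroup (𝟙 (p ≤ᵇ c)) (𝟙 (q ≤ᵇ p)) (𝟙 (q ≤ᵇ c)) ⟩
  (1ℚ - 𝟙 (q ≤ᵇ p)) + 𝟙 (q ≤ᵇ c) - 𝟙 (p ≤ᵇ c)
    ≡⟨ cong (λ u → u + 𝟙 (q ≤ᵇ c) - 𝟙 (p ≤ᵇ c)) (𝟙-<ᵇ-complement q p) ⟨
  𝟙 (p <ᵇ q) + 𝟙 (q ≤ᵇ c) - 𝟙 (p ≤ᵇ c) ∎
  where
  open ≡-Reasoning
  regroup : ∀ A B C → (1ℚ - A) - B + C ≡ (1ℚ - B) + C - A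
  regroup = solve-∀ ℚ-ring

data CycSuc (n i j : ℕ) : Set where
  step : suc i ℕ.< n → j ≡ suc i → CycSuc n i j
  wrap : suc i ≡ n → j ≡ 0 → CycSuc n i j

cycSuc-view : ∀ {n} (i : Fin n) → CycSuc n (toℕ i) (toℕ (cycSuc i))
cycSuc-view {suc m} i with suc (toℕ i) ℕ.<? suc m
... | yes i+1<n = step i+1<n (Fin.toℕ-fromℕ< i+1<n)
... | no  i+1≮n = wrap (ℕ.≤-antisym (Fin.toℕ<n i) (ℕ.≮⇒≥ i+1≮n)) refl

𝟙-≤ᵇ-cycSuc-threshold : ∀ {n q q' v} → CycSuc n q q' → v ℕ.< n →
  𝟙 (q ≤ᵇ v) - 𝟙 (q' ≤ᵇ v) ≡ 𝟙 (v ≡ᵇ q) - 𝟙 (suc q ≡ᵇ n)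
𝟙-≤ᵇ-cycSuc-threshold {q = q} {v = v} (step q+1<n refl) _
  rewrite ≡ᵇ-false (ℕ.<⇒≢ q+1<n) with ℕ.<-cmp v q
... | tri< v<q _ _ rewrite ≤ᵇ-false v<q | <ᵇ-false (ℕ.<⇒≤ v<q) | ≡ᵇ-false (ℕ.<⇒≢ v<q) = refl
... | tri≈ _ refl _
  rewrite ≤ᵇ-true (ℕ.≤-refl {v}) | <ᵇ-false (ℕ.≤-refl {v}) | ≡ᵇ-true (refl {x = v}) = refl
... | tri> _ _ q<v rewrite ≤ᵇ-true (ℕ.<⇒≤ q<v) | <ᵇ-true q<v | ≡ᵇ-false (ℕ.>⇒≢ q<v) = refl
𝟙-≤ᵇ-cycSuc-threshold {q = q} {v = v} (wrap refl refl) v<n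
  rewrite ≡ᵇ-true (refl {x = q}) with ℕ.m≤n⇒m<n∨m≡n (ℕ.≤-pred v<n)
... | inj₁ v<q rewrite ≤ᵇ-false v<q | ≡ᵇ-false (ℕ.<⇒≢ v<q) = refl
... | inj₂ refl rewrite ≤ᵇ-true (ℕ.≤-refl {v}) | ≡ᵇ-true (refl {x = v}) = refl

𝟙-≤ᵇ-cycSuc-argument : ∀ {n p p' q} → CycSuc n p p' → q ℕ.< n →
  𝟙 (q ≤ᵇ p') - 𝟙 (q ≤ᵇ p) ≡ 𝟙 (p' ≡ᵇ q) - 𝟙 (p' ≡ᵇ 0)
𝟙-≤ᵇ-cycSuc-argument {p = p} {q = q} (step _ refl) _ with ℕ.<-cmp q (suc p)
... | tri< q<p+1 _ _
  rewrite ≤ᵇ-true (ℕ.<⇒≤ q<p+1) | ≤ᵇ-true (ℕ.≤-pred q<p+1) | ≡ᵇ-false (ℕ.>⇒≢ q<p+1) = refl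
... | tri≈ _ refl _
  rewrite ≤ᵇ-true (ℕ.≤-refl {suc p}) | ≤ᵇ-false (ℕ.n<1+n p) | ≡ᵇ-true (refl {x = p}) = refl
... | tri> _ _ p+1<q
  rewrite ≤ᵇ-false p+1<q | ≤ᵇ-false (ℕ.<-trans (ℕ.n<1+n p) p+1<q) | ≡ᵇ-false (ℕ.<⇒≢ p+1<q) = refl
𝟙-≤ᵇ-cycSuc-argument {q = zero}  (wrap refl refl) _ = refl
𝟙-≤ᵇ-cycSuc-argument {q = suc q} (wrap refl refl) q<n rewrite ≤ᵇ-true (ℕ.≤-pred q<n) = refl

cycSuc-≢ : ∀ {m} (i : Fin (suc (suc m))) → cycSuc i ≢ i
cycSuc-≢ i i+1≡i with cycSuc-view i
... | step _ e = ℕ.1+n≢n (trans (sym e) (cong toℕ i+1≡i))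
... | wrap e e' = ℕ.0≢1+n (trans (sym e') (trans (cong toℕ i+1≡i) (ℕ.suc-injective e)))

-- Rationals and finite sums

toℚ≡mkℚ : ∀ m → toℚ m ≡ mkℚ (ℤ.+ m) 0 (Coprimality.sym (Coprimality.1-coprimeTo m))
toℚ≡mkℚ m = normalize-coprime _

toℚ-suc : ∀ m → toℚ (suc m) ≡ 1ℚ + toℚ m
toℚ-suc m rewrite toℚ≡mkℚ m = cong (_/ 1) (cong (ℤ._+_ (ℤ.+ 1)) (sym (ℤ.*-identityʳ (ℤ.+ m))))

toℚ-nonneg : ∀ m → 0ℚ ≤ toℚ m
toℚ-nonneg m = nonNegative⁻¹ (toℚ m) {{normalize-nonNeg m 1}}

toℚ-pos : ∀ m → 0ℚ < toℚ (suc m)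
toℚ-pos m = positive⁻¹ (toℚ (suc m)) {{normalize-pos (suc m) 1}}

p≤q⇒0≤q-p : ∀ {p q} → p ≤ q → 0ℚ ≤ q - p
p≤q⇒0≤q-p {p} {q} p≤q = subst (_≤ q - p) (+-inverseʳ p) (+-monoˡ-≤ (- p) p≤q)

0≤q-p⇒p≤q : ∀ {p q} → 0ℚ ≤ q - p → p ≤ q
0≤q-p⇒p≤q {p} {q} 0≤q-p = subst₂ _≤_ (+-identityˡ p) (cancel p q) (+-monoˡ-≤ p 0≤q-p)
  where
  cancel : ∀ p q → q - p + p ≡ q
  cancel = solve-∀ ℚ-ring

p≤p+q : ∀ p {q} → 0ℚ ≤ q → p ≤ p + q
p≤p+q p 0≤q = subst (_≤ p + _) (+-identityʳ p) (+-monoʳ-≤ p 0≤q)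

p-1<p : ∀ p → p - 1ℚ < p
p-1<p p = subst (p - 1ℚ <_) (+-identityʳ p) (+-monoʳ-< p (negative⁻¹ (- 1ℚ)))

sumℚ≡sum : ∀ {n} (f : Fin n → ℚ) → sumℚ f ≡ sum f
sumℚ≡sum {zero}  f = refl
sumℚ≡sum {suc n} f = cong (f zero +_) (sumℚ≡sum (f ∘ suc))

sumℚ-cong : ∀ {n} {f g : Fin n → ℚ} → (∀ i → f i ≡ g i) → sumℚ f ≡ sumℚ g
sumℚ-cong {f = f} {g} f≗g = trans (sumℚ≡sum f) (trans (sum-cong-≗ f≗g) (sym (sumℚ≡sum g)))

sumℚ-0 : ∀ n → sumℚ {n} (λ _ → 0ℚ) ≡ 0ℚ
sumℚ-0 n = trans (sumℚ≡sum {n} (λ _ → 0ℚ)) (sum-replicate-zero n)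

sumℚ-+ : ∀ {n} (f g : Fin n → ℚ) → sumℚ (λ i → f i + g i) ≡ sumℚ f + sumℚ g
sumℚ-+ f g = trans (sumℚ≡sum (λ i → f i + g i))
  (trans (∑-distrib-+ f g) (sym (cong₂ _+_ (sumℚ≡sum f) (sumℚ≡sum g))))

sumℚ-*ˡ : ∀ {n} c (f : Fin n → ℚ) → sumℚ (λ i → c * f i) ≡ c * sumℚ f
sumℚ-*ˡ c f = trans (sumℚ≡sum (λ i → c * f i))
  (sym (trans (cong (c *_) (sumℚ≡sum f)) (*-distribˡ-sum c f)))

sumℚ-*ʳ : ∀ {n} c (f : Fin n → ℚ) → sumℚ (λ i → f i * c) ≡ sumℚ f * c
sumℚ-*ʳ c f = trans (sumℚ-cong (λ i → *-comm (f i) c)) (trans (sumℚ-*ˡ c f) (*-comm c _))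

sumℚ-neg : ∀ {n} (f : Fin n → ℚ) → sumℚ (λ i → - f i) ≡ - sumℚ f
sumℚ-neg {zero}  f = refl
sumℚ-neg {suc n} f = trans (cong (- f zero +_) (sumℚ-neg (f ∘ suc))) (sym (neg-distrib-+ (f zero) _))

sumℚ-- : ∀ {n} (f g : Fin n → ℚ) → sumℚ (λ i → f i - g i) ≡ sumℚ f - sumℚ g
sumℚ-- f g = trans (sumℚ-+ f (λ i → - g i)) (cong (sumℚ f +_) (sumℚ-neg g))

sumℚ-*-distribʳ-- : ∀ {n} (u u' f : Fin n → ℚ) →
  sumℚ (λ j → (u j - u' j) * f j) ≡ sumℚ (λ j → u j * f j) - sumℚ (λ j → u' j * f j)
sumℚ-*-distribʳ-- u u' f = trans (sumℚ-cong (λ j → distrib (u j) (u' j) (f j)))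
  (sumℚ-- (λ j → u j * f j) (λ j → u' j * f j))
  where
  distrib : ∀ a b c → (a - b) * c ≡ a * c - b * c
  distrib = solve-∀ ℚ-ring

sumℚ-comm : ∀ {m n} (f : Fin m → Fin n → ℚ) →
  sumℚ (λ a → sumℚ (λ i → f a i)) ≡ sumℚ (λ i → sumℚ (λ a → f a i))
sumℚ-comm f = begin
  sumℚ (λ a → sumℚ (f a))            ≡⟨ sumℚ-cong (λ a → sumℚ≡sum (f a)) ⟩
  sumℚ (λ a → sum (f a))             ≡⟨ sumℚ≡sum (λ a → sum (f a)) ⟩
  sum (λ a → sum (f a))              ≡⟨ ∑-comm f ⟩
  sum (λ i → sum (λ a → f a i))      ≡⟨ sumℚ≡sum (λ i → sum (λ a → f a i)) ⟨
  sumℚ (λ i → sum (λ a → f a i))     ≡⟨ sumℚ-cong (λ i → sumℚ≡sum (λ a → f a i)) ⟨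
  sumℚ (λ i → sumℚ (λ a → f a i))    ∎
  where open ≡-Reasoning

sumℚ-linear : ∀ {m n} (t : Fin m → ℚ) (f : Fin m → Fin n → ℚ) →
  sumℚ (λ i → sumℚ (λ c → t c * f c i)) ≡ sumℚ (λ c → t c * sumℚ (f c))
sumℚ-linear t f = trans (sym (sumℚ-comm (λ c i → t c * f c i))) (sumℚ-cong (λ c → sumℚ-*ˡ (t c) (f c)))

sumℚ-permute : ∀ {n} (π : Permutation′ n) (f : Fin n → ℚ) → sumℚ (λ i → f (π ⟨$⟩ʳ i)) ≡ sumℚ f
sumℚ-permute π f = trans (sumℚ≡sum (λ i → f (π ⟨$⟩ʳ i))) (sym (trans (sumℚ≡sum f) (∑-permute f π)))

sumℚ-init-last : ∀ {m} (f : Fin (suc m) → ℚ) → sumℚ f ≡ sumℚ (f ∘ inject₁) + f (fromℕ m)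
sumℚ-init-last f = trans (sumℚ≡sum f)
  (trans (sum-init-last f) (cong (_+ f (fromℕ _)) (sym (sumℚ≡sum (f ∘ inject₁)))))

sumℚ-mono : ∀ {n} {f g : Fin n → ℚ} → (∀ i → f i ≤ g i) → sumℚ f ≤ sumℚ g
sumℚ-mono {zero}  f≤g = ≤-refl
sumℚ-mono {suc n} f≤g = +-mono-≤ (f≤g zero) (sumℚ-mono (f≤g ∘ suc))

count≡sumℚ : ∀ {n} (f : Fin n → Bool) → toℚ (count f) ≡ sumℚ (𝟙 ∘ f)
count≡sumℚ {zero}  f = refl
count≡sumℚ {suc n} f = trans (head (f zero)) (cong (𝟙 (f zero) +_) (count≡sumℚ (f ∘ suc)))
  where
  head : ∀ b → toℚ ((if b then 1 else 0) ℕ.+ count (f ∘ suc)) ≡ 𝟙 b + toℚ (count (f ∘ suc))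
  head true  = toℚ-suc (count (f ∘ suc))
  head false = sym (+-identityˡ _)

δ : ∀ {n} → Fin n → Fin n → ℚ
δ i j = 𝟙 (toℕ i ≡ᵇ toℕ j)

δ-nonneg : ∀ {n} (i j : Fin n) → 0ℚ ≤ δ i j
δ-nonneg i j = 𝟙-nonneg (toℕ i ≡ᵇ toℕ j)

δ-refl : ∀ {n} (i : Fin n) → δ i i ≡ 1ℚ
δ-refl i = cong 𝟙 (≡ᵇ-true (refl {x = toℕ i}))

δ-≢ : ∀ {n} {i j : Fin n} → i ≢ j → δ i j ≡ 0ℚ
δ-≢ i≢j = cong 𝟙 (≡ᵇ-false (i≢j ∘ Fin.toℕ-injective))

sumℚ-δ : ∀ {n} (q : Fin n) (f : Fin n → ℚ) → sumℚ (λ j → δ j q * f j) ≡ f q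
sumℚ-δ {suc n} zero f = begin
  1ℚ * f zero + sumℚ (λ j → 0ℚ * f (suc j))
    ≡⟨ cong₂ _+_ (*-identityˡ (f zero)) (trans (sumℚ-cong (λ j → *-zeroˡ (f (suc j)))) (sumℚ-0 n)) ⟩
  f zero + 0ℚ ≡⟨ +-identityʳ _ ⟩
  f zero ∎
  where open ≡-Reasoning
sumℚ-δ {suc n} (suc q) f =
  trans (cong₂ _+_ (*-zeroˡ (f zero)) (sumℚ-δ q (f ∘ suc))) (+-identityˡ (f (suc q)))

≤-convexCombination : ∀ {n} {t G : Fin n → ℚ} {L} → (∀ c → 0ℚ ≤ t c) → sumℚ t ≡ 1ℚ →
  (∀ c → L ≤ G c) → L ≤ sumℚ (λ c → t c * G c)
≤-convexCombination {t = t} {G} {L} t≥0 Σt≡1 L≤G = begin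
  L                       ≡⟨ trans (cong (_* L) Σt≡1) (*-identityˡ L) ⟨
  sumℚ t * L              ≡⟨ sumℚ-*ʳ L t ⟨
  sumℚ (λ c → t c * L)    ≤⟨ sumℚ-mono (λ c → *-monoˡ-≤-nonNeg (t c) {{nonNegative (t≥0 c)}} (L≤G c)) ⟩
  sumℚ (λ c → t c * G c)  ∎
  where open ≤-Reasoning

convexCombination-≤ : ∀ {n} {t G : Fin n → ℚ} {U} → (∀ c → 0ℚ ≤ t c) → sumℚ t ≡ 1ℚ →
  (∀ c → G c ≤ U) → sumℚ (λ c → t c * G c) ≤ U
convexCombination-≤ {t = t} {G} {U} t≥0 Σt≡1 G≤U = begin
  sumℚ (λ c → t c * G c)  ≤⟨ sumℚ-mono (λ c → *-monoˡ-≤-nonNeg (t c) {{nonNegative (t≥0 c)}} (G≤U c)) ⟩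
  sumℚ (λ c → t c * U)    ≡⟨ sumℚ-*ʳ U t ⟩
  sumℚ t * U              ≡⟨ trans (cong (_* U) Σt≡1) (*-identityˡ U) ⟩
  U                       ∎
  where open ≤-Reasoning

cycSuc-inject₁ : ∀ {m} (i : Fin m) → cycSuc (inject₁ i) ≡ suc i
cycSuc-inject₁ i with cycSuc-view (inject₁ i)
... | step _ e = Fin.toℕ-injective (trans e (cong suc (Fin.toℕ-inject₁ i)))
... | wrap e _ =
  contradiction (Fin.toℕ<n i) (ℕ.<-irrefl (trans (sym (Fin.toℕ-inject₁ i)) (ℕ.suc-injective e)))

cycSuc-fromℕ : ∀ m → cycSuc (fromℕ m) ≡ zero
cycSuc-fromℕ m with cycSuc-view (fromℕ m)
... | step i+1<n _ = contradiction i+1<n (ℕ.<-irrefl (cong suc (Fin.toℕ-fromℕ m)))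
... | wrap _ e     = Fin.toℕ-injective e

sumℚ-cycSuc : ∀ {n} (f : Fin n → ℚ) → sumℚ (f ∘ cycSuc) ≡ sumℚ f
sumℚ-cycSuc {zero}  f = refl
sumℚ-cycSuc {suc m} f = begin
  sumℚ (f ∘ cycSuc)                                  ≡⟨ sumℚ-init-last (f ∘ cycSuc) ⟩
  sumℚ (f ∘ cycSuc ∘ inject₁) + f (cycSuc (fromℕ m)) ≡⟨ cong₂ _+_ (sumℚ-cong (cong f ∘ cycSuc-inject₁))
                                                                    (cong f (cycSuc-fromℕ m)) ⟩
  sumℚ (f ∘ suc) + f zero                            ≡⟨ +-comm (sumℚ (f ∘ suc)) (f zero) ⟩
  sumℚ f                                             ∎
  where open ≡-Reasoning

sumℚ-telescope : ∀ {n} (f : Fin n → ℚ) → sumℚ (λ i → f i - f (cycSuc i)) ≡ 0ℚ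
sumℚ-telescope f =
  trans (sumℚ-- f (f ∘ cycSuc)) (trans (cong (_-_ (sumℚ f)) (sumℚ-cycSuc f)) (+-inverseʳ (sumℚ f)))

-- Cyclic intervals and tail sums

tailSum : ∀ {n} → (Fin n → ℚ) → Fin n → ℚ
tailSum y u = sumℚ (λ v → 𝟙 (toℕ u ≤ᵇ toℕ v) * y v)

isLast : ∀ {n} → Fin n → Bool
isLast {n} i = suc (toℕ i) ≡ᵇ n

tailSum-zero : ∀ {n} (y : Fin (suc n) → ℚ) → tailSum y zero ≡ sumℚ y
tailSum-zero y = sumℚ-cong (λ v → *-identityˡ (y v))

tailSum-cong : ∀ {n} {y y' : Fin n → ℚ} → (∀ v → y v ≡ y' v) → ∀ u → tailSum y u ≡ tailSum y' u
tailSum-cong y≗y' u = sumℚ-cong (λ v → cong (𝟙 (toℕ u ≤ᵇ toℕ v) *_) (y≗y' v))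

tailSum-+ : ∀ {n} (y y' : Fin n → ℚ) u → tailSum (λ v → y v + y' v) u ≡ tailSum y u + tailSum y' u
tailSum-+ y y' u = trans (sumℚ-cong (λ v → *-distribˡ-+ (𝟙 (toℕ u ≤ᵇ toℕ v)) (y v) (y' v)))
  (sumℚ-+ (λ v → 𝟙 (toℕ u ≤ᵇ toℕ v) * y v) (λ v → 𝟙 (toℕ u ≤ᵇ toℕ v) * y' v))

tailSum-cycSuc : ∀ {n} (y : Fin n → ℚ) i →
  tailSum y i - tailSum y (cycSuc i) ≡ y i - 𝟙 (isLast i) * sumℚ y
tailSum-cycSuc {n} y i = begin
  tailSum y i - tailSum y (cycSuc i)
    ≡⟨ sumℚ-*-distribʳ-- (λ v → 𝟙 (toℕ i ≤ᵇ toℕ v)) (λ v → 𝟙 (toℕ (cycSuc i) ≤ᵇ toℕ v)) y ⟨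
  sumℚ (λ v → (𝟙 (toℕ i ≤ᵇ toℕ v) - 𝟙 (toℕ (cycSuc i) ≤ᵇ toℕ v)) * y v)
    ≡⟨ sumℚ-cong (λ v → cong (_* y v) (𝟙-≤ᵇ-cycSuc-threshold (cycSuc-view i) (Fin.toℕ<n v))) ⟩
  sumℚ (λ v → (δ v i - 𝟙 (isLast i)) * y v)
    ≡⟨ sumℚ-*-distribʳ-- (λ v → δ v i) (λ _ → 𝟙 (isLast i)) y ⟩
  sumℚ (λ v → δ v i * y v) - sumℚ (λ v → 𝟙 (isLast i) * y v)
    ≡⟨ cong₂ _-_ (sumℚ-δ i y) (sumℚ-*ˡ (𝟙 (isLast i)) y) ⟩
  y i - 𝟙 (isLast i) * sumℚ y ∎
  where open ≡-Reasoning

tailSum-telescope : ∀ {m} (f : Fin (suc m) → ℚ) q → tailSum (λ p → f p - f (cycSuc p)) q ≡ f q - f zero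
tailSum-telescope f q = begin
  sumℚ (λ p → A p * (f p - f (cycSuc p)))
    ≡⟨ sumℚ-cong (λ p → *-distribˡ-- (A p) (f p) (f (cycSuc p))) ⟩
  sumℚ (λ p → A p * f p - A p * f (cycSuc p))
    ≡⟨ sumℚ-- (λ p → A p * f p) (λ p → A p * f (cycSuc p)) ⟩
  sumℚ (λ p → A p * f p) - sumℚ (λ p → A p * f (cycSuc p))
    ≡⟨ cong (_- sumℚ (λ p → A p * f (cycSuc p))) (sumℚ-cycSuc (λ p → A p * f p)) ⟨
  sumℚ (λ p → A (cycSuc p) * f (cycSuc p)) - sumℚ (λ p → A p * f (cycSuc p))
    ≡⟨ sumℚ-*-distribʳ-- (A ∘ cycSuc) A (f ∘ cycSuc) ⟨
  sumℚ (λ p → (A (cycSuc p) - A p) * f (cycSuc p))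
    ≡⟨ sumℚ-cong (λ p → cong (_* f (cycSuc p)) (𝟙-≤ᵇ-cycSuc-argument (cycSuc-view p) (Fin.toℕ<n q))) ⟩
  sumℚ (λ p → (δ (cycSuc p) q - δ (cycSuc p) zero) * f (cycSuc p))
    ≡⟨ sumℚ-cycSuc (λ j → (δ j q - δ j zero) * f j) ⟩
  sumℚ (λ j → (δ j q - δ j zero) * f j)
    ≡⟨ sumℚ-*-distribʳ-- (λ j → δ j q) (λ j → δ j zero) f ⟩
  sumℚ (λ j → δ j q * f j) - sumℚ (λ j → δ j zero * f j)
    ≡⟨ cong₂ _-_ (sumℚ-δ q f) (sumℚ-δ zero f) ⟩
  f q - f zero ∎
  where
  open ≡-Reasoning
  A : Fin _ → ℚ
  A p = 𝟙 (toℕ q ≤ᵇ toℕ p)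
  *-distribˡ-- : ∀ a b c → a * (b - c) ≡ a * b - a * c
  *-distribˡ-- = solve-∀ ℚ-ring

tailSum-isLast : ∀ {m} (q : Fin (suc m)) → tailSum (𝟙 ∘ isLast) q ≡ 1ℚ
tailSum-isLast {m} q = begin
  tailSum (𝟙 ∘ isLast) q
    ≡⟨ sumℚ-cong (λ p → trans (*-comm (𝟙 (toℕ q ≤ᵇ toℕ p)) (𝟙 (isLast p)))
                              (cong (_* 𝟙 (toℕ q ≤ᵇ toℕ p)) (isLast≡δ p))) ⟩
  sumℚ (λ p → δ p (fromℕ m) * 𝟙 (toℕ q ≤ᵇ toℕ p))
    ≡⟨ sumℚ-δ (fromℕ m) (λ p → 𝟙 (toℕ q ≤ᵇ toℕ p)) ⟩
  𝟙 (toℕ q ≤ᵇ toℕ (fromℕ m))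
    ≡⟨ cong 𝟙 (≤ᵇ-true (subst (toℕ q ℕ.≤_) (sym (Fin.toℕ-fromℕ m)) (ℕ.≤-pred (Fin.toℕ<n q)))) ⟩
  1ℚ ∎
  where
  open ≡-Reasoning
  isLast≡δ : ∀ p → 𝟙 (isLast p) ≡ δ p (fromℕ m)
  isLast≡δ p = cong (λ k → 𝟙 (toℕ p ≡ᵇ k)) (sym (Fin.toℕ-fromℕ m))

xInt≡sumℚ-𝟙 : ∀ {n} (a b : Fin n) y → xInt a b y ≡ sumℚ (λ v → 𝟙 (inInt a b v) * y v)
xInt≡sumℚ-𝟙 a b y = sumℚ-cong (λ v → if-then-0≡𝟙* (inInt a b v) (y v))

xInt-cong : ∀ {n} (a b : Fin n) {y y'} → (∀ v → y v ≡ y' v) → xInt a b y ≡ xInt a b y'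
xInt-cong a b y≗y' = sumℚ-cong (λ v → cong (if inInt a b v then_else 0ℚ) (y≗y' v))

xInt-+ : ∀ {n} (a b : Fin n) y y' → xInt a b (λ v → y v + y' v) ≡ xInt a b y + xInt a b y'
xInt-+ a b y y' = trans (sumℚ-cong (λ v → split (inInt a b v) (y v) (y' v)))
  (sumℚ-+ (λ v → if inInt a b v then y v else 0ℚ) (λ v → if inInt a b v then y' v else 0ℚ))
  where
  split : ∀ s p q → (if s then p + q else 0ℚ) ≡ (if s then p else 0ℚ) + (if s then q else 0ℚ)
  split true  p q = refl
  split false p q = refl

xInt-- : ∀ {n} (a b : Fin n) y y' → xInt a b (λ v → y v - y' v) ≡ xInt a b y - xInt a b y'
xInt-- a b y y' = trans (sumℚ-cong (λ v → split (inInt a b v) (y v) (y' v)))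
  (sumℚ-- (λ v → if inInt a b v then y v else 0ℚ) (λ v → if inInt a b v then y' v else 0ℚ))
  where
  split : ∀ s p q → (if s then p - q else 0ℚ) ≡ (if s then p else 0ℚ) - (if s then q else 0ℚ)
  split true  p q = refl
  split false p q = refl

xInt-linear : ∀ {n k} (a b : Fin n) (t : Fin k → ℚ) (f : Fin k → Fin n → ℚ) →
  xInt a b (λ i → sumℚ (λ c → t c * f c i)) ≡ sumℚ (λ c → t c * xInt a b (f c))
xInt-linear a b t f = begin
  xInt a b (λ i → sumℚ (λ c → t c * f c i))
    ≡⟨ xInt≡sumℚ-𝟙 a b (λ i → sumℚ (λ c → t c * f c i)) ⟩
  sumℚ (λ i → M i * sumℚ (λ c → t c * f c i))
    ≡⟨ sumℚ-cong (λ i → trans (sym (sumℚ-*ˡ (M i) (λ c → t c * f c i)))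
                              (sumℚ-cong (λ c → swap (M i) (t c) (f c i)))) ⟩
  sumℚ (λ i → sumℚ (λ c → t c * (M i * f c i)))
    ≡⟨ sumℚ-linear t (λ c i → M i * f c i) ⟩
  sumℚ (λ c → t c * sumℚ (λ i → M i * f c i))
    ≡⟨ sumℚ-cong (λ c → cong (t c *_) (xInt≡sumℚ-𝟙 a b (f c))) ⟨
  sumℚ (λ c → t c * xInt a b (f c)) ∎
  where
  open ≡-Reasoning
  M : Fin _ → ℚ
  M i = 𝟙 (inInt a b i)
  swap : ∀ m t y → m * (t * y) ≡ t * (m * y)
  swap = solve-∀ ℚ-ring

xInt-tailSum : ∀ {n} (a b : Fin n) y →
  xInt a b y ≡ tailSum y a - tailSum y b + 𝟙 (toℕ b <ᵇ toℕ a) * sumℚ y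
xInt-tailSum a b y = begin
  xInt a b y
    ≡⟨ xInt≡sumℚ-𝟙 a b y ⟩
  sumℚ (λ v → 𝟙 (inInt a b v) * y v)
    ≡⟨ sumℚ-cong (λ v → trans (cong (_* y v) (𝟙-inInt v)) (expand (A a v) (A b v) c (y v))) ⟩
  sumℚ (λ v → (A a v * y v - A b v * y v) + c * y v)
    ≡⟨ sumℚ-+ (λ v → A a v * y v - A b v * y v) (λ v → c * y v) ⟩
  sumℚ (λ v → A a v * y v - A b v * y v) + sumℚ (λ v → c * y v)
    ≡⟨ cong₂ _+_ (sumℚ-- (λ v → A a v * y v) (λ v → A b v * y v)) (sumℚ-*ˡ c y) ⟩
  tailSum y a - tailSum y b + c * sumℚ y ∎
  where
  open ≡-Reasoning
  A : Fin _ → Fin _ → ℚ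
  A u v = 𝟙 (toℕ u ≤ᵇ toℕ v)
  c : ℚ
  c = 𝟙 (toℕ b <ᵇ toℕ a)
  𝟙-inInt : ∀ v → 𝟙 (inInt a b v) ≡ A a v - A b v + c
  𝟙-inInt v = 𝟙-cycDist-< (ℕ.<⇒≤ (Fin.toℕ<n a)) (Fin.toℕ<n b) (Fin.toℕ<n v)
  expand : ∀ A B C Y → (A - B + C) * Y ≡ (A * Y - B * Y) + C * Y
  expand = solve-∀ ℚ-ring

xInt-telescope : ∀ {n} (a b : Fin n) (f : Fin n → ℚ) → xInt a b (λ i → f i - f (cycSuc i)) ≡ f a - f b
xInt-telescope {suc m} a b f = begin
  xInt a b h
    ≡⟨ xInt-tailSum a b h ⟩
  tailSum h a - tailSum h b + c * sumℚ h
    ≡⟨ cong₂ (λ u v → u + c * v) (cong₂ _-_ (tailSum-telescope f a) (tailSum-telescope f b))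
                                  (sumℚ-telescope f) ⟩
  (f a - f zero) - (f b - f zero) + c * 0ℚ
    ≡⟨ cancel (f a) (f b) (f zero) c ⟩
  f a - f b ∎
  where
  open ≡-Reasoning
  h : Fin (suc m) → ℚ
  h i = f i - f (cycSuc i)
  c : ℚ
  c = 𝟙 (toℕ b <ᵇ toℕ a)
  cancel : ∀ A B Z C → (A - Z) - (B - Z) + C * 0ℚ ≡ A - B
  cancel = solve-∀ ℚ-ring

-- Vertices of the w-simplex

module _ {n : ℕ} (w : Permutation′ n) where

  eCdes : Fin n → ℚ
  eCdes i = 𝟙 (cdes w i)

  atOrBefore : Fin n → Fin n → ℚ
  atOrBefore c i = 𝟙 (pos w i ≤ᵇ pos w c)

  atOrBefore-refl : ∀ c → atOrBefore c c ≡ 1ℚ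
  atOrBefore-refl c = cong 𝟙 (≤ᵇ-true (ℕ.≤-refl {pos w c}))

  atOrBefore-position : ∀ p i → atOrBefore (w ⟨$⟩ʳ p) i ≡ 𝟙 (toℕ (w ⟨$⟩ˡ i) ≤ᵇ toℕ p)
  atOrBefore-position p i = cong (λ q → 𝟙 (pos w i ≤ᵇ toℕ q)) (inverseˡ w)

  eI-via-cdes : ∀ c i → eI w c i ≡ eCdes i + (atOrBefore c i - atOrBefore c (cycSuc i))
  eI-via-cdes c i =
    trans (𝟙-rotation-< (Fin.toℕ<n (w ⟨$⟩ˡ c)) (Fin.toℕ<n (w ⟨$⟩ˡ cycSuc i)) (Fin.toℕ<n (w ⟨$⟩ˡ i)))
    (+-assoc (eCdes i) (atOrBefore c i) (- atOrBefore c (cycSuc i)))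

  cardI∩≡xInt-eI : ∀ c a b → toℚ (cardI∩ w c a b) ≡ xInt a b (eI w c)
  cardI∩≡xInt-eI c a b = trans (count≡sumℚ (λ v → if I w c v then inInt a b v else false))
    (sumℚ-cong (λ v → 𝟙-if (I w c v) (inInt a b v)))
    where
    𝟙-if : ∀ s t → 𝟙 (if s then t else false) ≡ (if t then 𝟙 s else 0ℚ)
    𝟙-if true  true  = refl
    𝟙-if true  false = refl
    𝟙-if false true  = refl
    𝟙-if false false = refl

  cardI∩-via-cdes : ∀ c a b → toℚ (cardI∩ w c a b) ≡ xInt a b eCdes + (atOrBefore c a - atOrBefore c b)
  cardI∩-via-cdes c a b = begin
    toℚ (cardI∩ w c a b)
      ≡⟨ cardI∩≡xInt-eI c a b ⟩
    xInt a b (eI w c)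
      ≡⟨ xInt-cong a b (eI-via-cdes c) ⟩
    xInt a b (λ i → eCdes i + (atOrBefore c i - atOrBefore c (cycSuc i)))
      ≡⟨ xInt-+ a b eCdes (λ i → atOrBefore c i - atOrBefore c (cycSuc i)) ⟩
    xInt a b eCdes + xInt a b (λ i → atOrBefore c i - atOrBefore c (cycSuc i))
      ≡⟨ cong (xInt a b eCdes +_) (xInt-telescope a b (atOrBefore c)) ⟩
    xInt a b eCdes + (atOrBefore c a - atOrBefore c b) ∎
    where open ≡-Reasoning

  cardI∩-difference : ∀ c c' a b → toℚ (cardI∩ w c a b) - toℚ (cardI∩ w c' a b)
    ≡ (atOrBefore c a - atOrBefore c b) - (atOrBefore c' a - atOrBefore c' b)
  cardI∩-difference c c' a b =
    trans (cong₂ _-_ (cardI∩-via-cdes c a b) (cardI∩-via-cdes c' a b)) (cancel (xInt a b eCdes) _ _)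
    where
    cancel : ∀ K D D' → (K + D) - (K + D') ≡ D - D'
    cancel = solve-∀ ℚ-ring

  cardI∩-lower-bound : ∀ a b c → toℚ (cardI∩ w b a b) ≤ toℚ (cardI∩ w c a b)
  cardI∩-lower-bound a b c = 0≤q-p⇒p≤q (begin
    0ℚ
      ≤⟨ p≤q⇒0≤q-p (𝟙-≤ᵇ-trans (pos w a) (pos w b) (pos w c)) ⟩
    (1ℚ + atOrBefore c a) - (atOrBefore b a + atOrBefore c b)
      ≡⟨ regroup (atOrBefore b a) (atOrBefore c b) (atOrBefore c a) ⟩
    (atOrBefore c a - atOrBefore c b) - (atOrBefore b a - 1ℚ)
      ≡⟨ cong (λ u → (atOrBefore c a - atOrBefore c b) - (atOrBefore b a - u)) (atOrBefore-refl b) ⟨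
    (atOrBefore c a - atOrBefore c b) - (atOrBefore b a - atOrBefore b b)
      ≡⟨ cardI∩-difference c b a b ⟨
    toℚ (cardI∩ w c a b) - toℚ (cardI∩ w b a b) ∎)
    where
    open ≤-Reasoning
    regroup : ∀ X Y W → (1ℚ + W) - (X + Y) ≡ (W - Y) - (X - 1ℚ)
    regroup = solve-∀ ℚ-ring

  cardI∩-upper-bound : ∀ a b c → toℚ (cardI∩ w c a b) ≤ toℚ (cardI∩ w a a b)
  cardI∩-upper-bound a b c = 0≤q-p⇒p≤q (begin
    0ℚ
      ≤⟨ p≤q⇒0≤q-p (𝟙-≤ᵇ-trans (pos w b) (pos w a) (pos w c)) ⟩
    (1ℚ + atOrBefore c b) - (atOrBefore a b + atOrBefore c a)
      ≡⟨ regroup (atOrBefore a b) (atOrBefore c a) (atOrBefore c b) ⟩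
    (1ℚ - atOrBefore a b) - (atOrBefore c a - atOrBefore c b)
      ≡⟨ cong (λ u → (u - atOrBefore a b) - (atOrBefore c a - atOrBefore c b)) (atOrBefore-refl a) ⟨
    (atOrBefore a a - atOrBefore a b) - (atOrBefore c a - atOrBefore c b)
      ≡⟨ cardI∩-difference a c a b ⟨
    toℚ (cardI∩ w a a b) - toℚ (cardI∩ w c a b) ∎)
    where
    open ≤-Reasoning
    regroup : ∀ X Y W → (1ℚ + W) - (X + Y) ≡ (1ℚ - X) - (Y - W)
    regroup = solve-∀ ℚ-ring

  sumℚ-eI : ∀ c → sumℚ (eI w c) ≡ toℚ (count (cdes w))
  sumℚ-eI c = begin
    sumℚ (eI w c)
      ≡⟨ sumℚ-cong (eI-via-cdes c) ⟩
    sumℚ (λ i → eCdes i + (atOrBefore c i - atOrBefore c (cycSuc i)))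
      ≡⟨ sumℚ-+ eCdes (λ i → atOrBefore c i - atOrBefore c (cycSuc i)) ⟩
    sumℚ eCdes + sumℚ (λ i → atOrBefore c i - atOrBefore c (cycSuc i))
      ≡⟨ cong (sumℚ eCdes +_) (sumℚ-telescope (atOrBefore c)) ⟩
    sumℚ eCdes + 0ℚ
      ≡⟨ +-identityʳ (sumℚ eCdes) ⟩
    sumℚ eCdes
      ≡⟨ count≡sumℚ (cdes w) ⟨
    toℚ (count (cdes w)) ∎
    where open ≡-Reasoning

  vertexCombination : (Fin n → ℚ) → Fin n → ℚ
  vertexCombination t i = sumℚ (λ c → t c * eI w c i)

  xInt-vertexCombination : ∀ a b t →
    xInt a b (vertexCombination t) ≡ sumℚ (λ c → t c * toℚ (cardI∩ w c a b))
  xInt-vertexCombination a b t = trans (xInt-linear a b t (eI w))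
    (sumℚ-cong (λ c → cong (t c *_) (sym (cardI∩≡xInt-eI c a b))))

  sumℚ-vertexCombination : ∀ t → sumℚ (vertexCombination t) ≡ sumℚ t * toℚ (count (cdes w))
  sumℚ-vertexCombination t = begin
    sumℚ (vertexCombination t)                   ≡⟨ sumℚ-linear t (eI w) ⟩
    sumℚ (λ c → t c * sumℚ (eI w c))             ≡⟨ sumℚ-cong (λ c → cong (t c *_) (sumℚ-eI c)) ⟩
    sumℚ (λ c → t c * toℚ (count (cdes w)))      ≡⟨ sumℚ-*ʳ _ t ⟩
    sumℚ t * toℚ (count (cdes w))                ∎
    where open ≡-Reasoning

  vertexCombination-by-position : ∀ t i → vertexCombination t i
    ≡ eCdes i * sumℚ t + (tailSum (t ∘ (w ⟨$⟩ʳ_)) (w ⟨$⟩ˡ i) - tailSum (t ∘ (w ⟨$⟩ʳ_)) (w ⟨$⟩ˡ cycSuc i))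
  vertexCombination-by-position t i = begin
    sumℚ (λ c → t c * eI w c i)
      ≡⟨ sumℚ-permute w (λ c → t c * eI w c i) ⟨
    sumℚ (λ p → t′ p * eI w (w ⟨$⟩ʳ p) i)
      ≡⟨ sumℚ-cong (λ p → cong (t′ p *_) (trans (eI-via-cdes (w ⟨$⟩ʳ p) i)
           (cong₂ (λ u v → eCdes i + (u - v))
                  (atOrBefore-position p i) (atOrBefore-position p (cycSuc i))))) ⟩
    sumℚ (λ p → t′ p * (eCdes i + (A q p - A q′ p)))
      ≡⟨ sumℚ-cong (λ p → expand (t′ p) (eCdes i) (A q p) (A q′ p)) ⟩
    sumℚ (λ p → eCdes i * t′ p + (A q p - A q′ p) * t′ p)
      ≡⟨ sumℚ-+ (λ p → eCdes i * t′ p) (λ p → (A q p - A q′ p) * t′ p) ⟩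
    sumℚ (λ p → eCdes i * t′ p) + sumℚ (λ p → (A q p - A q′ p) * t′ p)
      ≡⟨ cong₂ _+_ (sumℚ-*ˡ (eCdes i) t′) (sumℚ-*-distribʳ-- (A q) (A q′) t′) ⟩
    eCdes i * sumℚ t′ + (tailSum t′ q - tailSum t′ q′)
      ≡⟨ cong (λ s → eCdes i * s + (tailSum t′ q - tailSum t′ q′)) (sumℚ-permute w t) ⟩
    eCdes i * sumℚ t + (tailSum t′ q - tailSum t′ q′) ∎
    where
    open ≡-Reasoning
    t′ : Fin n → ℚ
    t′ p = t (w ⟨$⟩ʳ p)
    q q′ : Fin n
    q  = w ⟨$⟩ˡ i
    q′ = w ⟨$⟩ˡ cycSuc i
    A : Fin n → Fin n → ℚ
    A u p = 𝟙 (toℕ u ≤ᵇ toℕ p)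
    expand : ∀ T D X Y → T * (D + (X - Y)) ≡ D * T + (X - Y) * T
    expand = solve-∀ ℚ-ring

  interval-bounds : ∀ a b x → InSimplex w x →
    (toℚ (cardI∩ w b a b) ≤ xInt a b x) × (xInt a b x ≤ toℚ (cardI∩ w a a b))
  interval-bounds a b x (t , t≥0 , Σt≡1 , x≡) =
      subst (_ ≤_) (sym xInt≡) (≤-convexCombination t≥0 Σt≡1 (cardI∩-lower-bound a b))
    , subst (_≤ _) (sym xInt≡) (convexCombination-≤ t≥0 Σt≡1 (cardI∩-upper-bound a b))
    where
    xInt≡ : xInt a b x ≡ sumℚ (λ c → t c * toℚ (cardI∩ w c a b))
    xInt≡ = trans (xInt-cong a b x≡) (xInt-vertexCombination a b t)

  InSimplex⇒sumℚ : ∀ {x} → InSimplex w x → sumℚ x ≡ toℚ (count (cdes w))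
  InSimplex⇒sumℚ {x} (t , _ , Σt≡1 , x≡) = begin
    sumℚ x                           ≡⟨ sumℚ-cong x≡ ⟩
    sumℚ (vertexCombination t)       ≡⟨ sumℚ-vertexCombination t ⟩
    sumℚ t * toℚ (count (cdes w))    ≡⟨ cong (_* toℚ (count (cdes w))) Σt≡1 ⟩
    1ℚ * toℚ (count (cdes w))        ≡⟨ *-identityˡ _ ⟩
    toℚ (count (cdes w))             ∎
    where open ≡-Reasoning

  -- Facets

  next : Fin n → Fin n
  next a = w ⟨$⟩ʳ cycSuc (w ⟨$⟩ˡ a)

  precedes-elim : ∀ {ℓ} {P : Fin n → Fin n → Set ℓ} →
    (∀ a → P a (next a)) → ∀ a b → Precedes w a b → P a b
  precedes-elim P-next a _ refl = P-next a

  pos-next : ∀ a → pos w (next a) ≡ toℕ (cycSuc (w ⟨$⟩ˡ a))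
  pos-next a = cong toℕ (inverseˡ w)

  next-position : ∀ p → next (w ⟨$⟩ʳ p) ≡ w ⟨$⟩ʳ cycSuc p
  next-position p = cong (λ q → w ⟨$⟩ʳ cycSuc q) (inverseˡ w)

  atOrBefore-next : ∀ c a →
    atOrBefore c a - atOrBefore c (next a) ≡ δ (w ⟨$⟩ˡ c) (w ⟨$⟩ˡ a) - 𝟙 (isLast (w ⟨$⟩ˡ a))
  atOrBefore-next c a = begin
    atOrBefore c a - atOrBefore c (next a)
      ≡⟨ cong (λ k → atOrBefore c a - 𝟙 (k ≤ᵇ pos w c)) (pos-next a) ⟩
    atOrBefore c a - 𝟙 (toℕ (cycSuc (w ⟨$⟩ˡ a)) ≤ᵇ pos w c)
      ≡⟨ 𝟙-≤ᵇ-cycSuc-threshold (cycSuc-view (w ⟨$⟩ˡ a)) (Fin.toℕ<n (w ⟨$⟩ˡ c)) ⟩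
    δ (w ⟨$⟩ˡ c) (w ⟨$⟩ˡ a) - 𝟙 (isLast (w ⟨$⟩ˡ a)) ∎
    where open ≡-Reasoning

  cardI∩-at-next : ∀ c a → toℚ (cardI∩ w c a (next a))
    ≡ xInt a (next a) eCdes + (δ (w ⟨$⟩ˡ c) (w ⟨$⟩ˡ a) - 𝟙 (isLast (w ⟨$⟩ˡ a)))
  cardI∩-at-next c a =
    trans (cardI∩-via-cdes c a (next a)) (cong (xInt a (next a) eCdes +_) (atOrBefore-next c a))

  slack : (Fin n → ℚ) → Fin n → ℚ
  slack x a = xInt a (next a) x - toℚ (cardI∩ w (next a) a (next a))

  equation-irredundant : ∀ {k} → count (cdes w) ≡ suc k → (c : Fin n) →
    ∃ λ x → (∀ a b → Precedes w a b → FacetIneq w a b x) × ¬ Eqn k x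
  equation-irredundant {k} descents c = x , (λ a b _ → facets a b) , Σx≢k+1
    where
    x : Fin n → ℚ
    x i = eI w c i + eI w c i
    facets : ∀ a b → FacetIneq w a b x
    facets a b = begin
      toℚ (cardI∩ w b a b)                        ≤⟨ cardI∩-lower-bound a b c ⟩
      toℚ (cardI∩ w c a b)                        ≤⟨ p≤p+q _ (toℚ-nonneg (cardI∩ w c a b)) ⟩
      toℚ (cardI∩ w c a b) + toℚ (cardI∩ w c a b)
        ≡⟨ cong₂ _+_ (cardI∩≡xInt-eI c a b) (cardI∩≡xInt-eI c a b) ⟩
      xInt a b (eI w c) + xInt a b (eI w c)       ≡⟨ xInt-+ a b (eI w c) (eI w c) ⟨
      xInt a b x                                  ∎
      where open ≤-Reasoning
    K : ℚ
    K = toℚ (suc k)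
    Σx≡2K : sumℚ x ≡ K + K
    Σx≡2K = trans (sumℚ-+ (eI w c) (eI w c)) (cong₂ _+_ ΣeI≡K ΣeI≡K)
      where
      ΣeI≡K : sumℚ (eI w c) ≡ K
      ΣeI≡K = trans (sumℚ-eI c) (cong toℚ descents)
    Σx≢k+1 : ¬ Eqn k x
    Σx≢k+1 Σx≡K = <-irrefl (sym K≡0) (toℚ-pos k)
      where
      open ≡-Reasoning
      double-cancel : ∀ K → (K + K) - K ≡ K
      double-cancel = solve-∀ ℚ-ring
      K≡0 : K ≡ 0ℚ
      K≡0 = begin
        K             ≡⟨ double-cancel K ⟨
        (K + K) - K   ≡⟨ cong (_- K) (trans (sym Σx≡2K) Σx≡K) ⟩
        K - K         ≡⟨ +-inverseʳ K ⟩
        0ℚ            ∎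

-- The facet description (n ≥ 2)

module _ {m : ℕ} (w : Permutation′ (suc (suc m))) where

  -- This is where n ≥ 2 is used: for n = 1, next a = a and the encoded interval
  -- [a, a-1] is empty rather than all of [n].
  δ-next : ∀ a → δ (w ⟨$⟩ˡ next w a) (w ⟨$⟩ˡ a) ≡ 0ℚ
  δ-next a = δ-≢ (λ e → cycSuc-≢ (w ⟨$⟩ˡ a) (trans (sym (inverseˡ w)) e))

  cardI∩-next-self : ∀ a → toℚ (cardI∩ w (next w a) a (next w a))
    ≡ xInt a (next w a) (eCdes w) - 𝟙 (isLast (w ⟨$⟩ˡ a))
  cardI∩-next-self a = trans (cardI∩-at-next w (next w a) a)
    (trans (cong (λ d → K + (d - ε)) (δ-next a)) (drop-zero K ε))
    where
    K ε : ℚ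
    K = xInt a (next w a) (eCdes w)
    ε = 𝟙 (isLast (w ⟨$⟩ˡ a))
    drop-zero : ∀ K E → K + (0ℚ - E) ≡ K - E
    drop-zero = solve-∀ ℚ-ring

  xInt-next-eI : ∀ c a → xInt a (next w a) (eI w c)
    ≡ toℚ (cardI∩ w (next w a) a (next w a)) + δ (w ⟨$⟩ˡ c) (w ⟨$⟩ˡ a)
  xInt-next-eI c a = begin
    xInt a (next w a) (eI w c)        ≡⟨ cardI∩≡xInt-eI w c a (next w a) ⟨
    toℚ (cardI∩ w c a (next w a))     ≡⟨ cardI∩-at-next w c a ⟩
    K + (d - ε)                       ≡⟨ regroup K d ε ⟩
    (K - ε) + d                       ≡⟨ cong (_+ d) (cardI∩-next-self a) ⟨
    toℚ (cardI∩ w (next w a) a (next w a)) + d ∎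
    where
    open ≡-Reasoning
    K d ε : ℚ
    K = xInt a (next w a) (eCdes w)
    d = δ (w ⟨$⟩ˡ c) (w ⟨$⟩ˡ a)
    ε = 𝟙 (isLast (w ⟨$⟩ˡ a))
    regroup : ∀ K D E → K + (D - E) ≡ (K - E) + D
    regroup = solve-∀ ℚ-ring

  slack≡ : ∀ x a → slack w x a ≡ xInt a (next w a) (λ i → x i - eCdes w i) + 𝟙 (isLast (w ⟨$⟩ˡ a))
  slack≡ x a = begin
    xInt a (next w a) x - toℚ (cardI∩ w (next w a) a (next w a))
      ≡⟨ cong (_-_ (xInt a (next w a) x)) (cardI∩-next-self a) ⟩
    xInt a (next w a) x - (xInt a (next w a) (eCdes w) - ε)
      ≡⟨ regroup (xInt a (next w a) x) (xInt a (next w a) (eCdes w)) ε ⟩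
    (xInt a (next w a) x - xInt a (next w a) (eCdes w)) + ε
      ≡⟨ cong (_+ ε) (xInt-- a (next w a) x (eCdes w)) ⟨
    xInt a (next w a) (λ i → x i - eCdes w i) + ε ∎
    where
    open ≡-Reasoning
    ε : ℚ
    ε = 𝟙 (isLast (w ⟨$⟩ˡ a))
    regroup : ∀ X K E → X - (K - E) ≡ (X - K) + E
    regroup = solve-∀ ℚ-ring

  module _ (x : Fin (suc (suc m)) → ℚ) (Σx≡Σd : sumℚ x ≡ sumℚ (eCdes w)) where

    private
      z : Fin (suc (suc m)) → ℚ
      z i = x i - eCdes w i

      Φ : Fin (suc (suc m)) → ℚ
      Φ p = tailSum z (w ⟨$⟩ʳ p)

      slack′ : Fin (suc (suc m)) → ℚ
      slack′ p = slack w x (w ⟨$⟩ʳ p)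

    sumℚ-z : sumℚ z ≡ 0ℚ
    sumℚ-z = trans (sumℚ-- x (eCdes w))
      (trans (cong (_- sumℚ (eCdes w)) Σx≡Σd) (+-inverseʳ (sumℚ (eCdes w))))

    slack-at-position : ∀ p → slack′ p ≡ Φ p - Φ (cycSuc p) + 𝟙 (isLast p)
    slack-at-position p = begin
      slack w x a
        ≡⟨ slack≡ x a ⟩
      xInt a (next w a) z + 𝟙 (isLast (w ⟨$⟩ˡ a))
        ≡⟨ cong₂ (λ u v → xInt a u z + 𝟙 (isLast v)) (next-position w p) (inverseˡ w) ⟩
      xInt a a′ z + 𝟙 (isLast p)
        ≡⟨ cong (_+ 𝟙 (isLast p)) (xInt-tailSum a a′ z) ⟩
      tailSum z a - tailSum z a′ + 𝟙 (toℕ a′ <ᵇ toℕ a) * sumℚ z + 𝟙 (isLast p)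
        ≡⟨ cong (λ s → tailSum z a - tailSum z a′ + 𝟙 (toℕ a′ <ᵇ toℕ a) * s + 𝟙 (isLast p)) sumℚ-z ⟩
      tailSum z a - tailSum z a′ + 𝟙 (toℕ a′ <ᵇ toℕ a) * 0ℚ + 𝟙 (isLast p)
        ≡⟨ drop-zero (tailSum z a) (tailSum z a′) (𝟙 (toℕ a′ <ᵇ toℕ a)) (𝟙 (isLast p)) ⟩
      Φ p - Φ (cycSuc p) + 𝟙 (isLast p) ∎
      where
      open ≡-Reasoning
      a a′ : Fin (suc (suc m))
      a  = w ⟨$⟩ʳ p
      a′ = w ⟨$⟩ʳ cycSuc p
      drop-zero : ∀ A B C E → A - B + C * 0ℚ + E ≡ A - B + E
      drop-zero = solve-∀ ℚ-ring

    tailSum-slack : ∀ q → tailSum slack′ q ≡ Φ q - Φ zero + 1ℚ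
    tailSum-slack q = begin
      tailSum slack′ q
        ≡⟨ tailSum-cong slack-at-position q ⟩
      tailSum (λ p → (Φ p - Φ (cycSuc p)) + 𝟙 (isLast p)) q
        ≡⟨ tailSum-+ (λ p → Φ p - Φ (cycSuc p)) (𝟙 ∘ isLast) q ⟩
      tailSum (λ p → Φ p - Φ (cycSuc p)) q + tailSum (𝟙 ∘ isLast) q
        ≡⟨ cong₂ _+_ (tailSum-telescope Φ q) (tailSum-isLast q) ⟩
      Φ q - Φ zero + 1ℚ ∎
      where open ≡-Reasoning

    sumℚ-slack : sumℚ (slack w x) ≡ 1ℚ
    sumℚ-slack = begin
      sumℚ (slack w x)         ≡⟨ sumℚ-permute w (slack w x) ⟨
      sumℚ slack′              ≡⟨ tailSum-zero slack′ ⟨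
      tailSum slack′ zero      ≡⟨ tailSum-slack zero ⟩
      Φ zero - Φ zero + 1ℚ     ≡⟨ cong (_+ 1ℚ) (+-inverseʳ (Φ zero)) ⟩
      0ℚ + 1ℚ                  ≡⟨ +-identityˡ 1ℚ ⟩
      1ℚ                       ∎
      where open ≡-Reasoning

    vertexCombination-slack : ∀ i → vertexCombination w (slack w x) i ≡ x i
    vertexCombination-slack i = begin
      vertexCombination w (slack w x) i
        ≡⟨ vertexCombination-by-position w (slack w x) i ⟩
      eCdes w i * sumℚ (slack w x) + (tailSum slack′ q - tailSum slack′ q′)
        ≡⟨ cong₂ (λ s u → eCdes w i * s + u) sumℚ-slack
                 (cong₂ _-_ (tailSum-slack q) (tailSum-slack q′)) ⟩
      eCdes w i * 1ℚ + ((Φ q - Φ zero + 1ℚ) - (Φ q′ - Φ zero + 1ℚ))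
        ≡⟨ cancel (eCdes w i) (Φ q) (Φ q′) (Φ zero) ⟩
      eCdes w i + (Φ q - Φ q′)
        ≡⟨ cong₂ (λ u v → eCdes w i + (tailSum z u - tailSum z v)) (inverseʳ w) (inverseʳ w) ⟩
      eCdes w i + (tailSum z i - tailSum z (cycSuc i))
        ≡⟨ cong (eCdes w i +_) (tailSum-cycSuc z i) ⟩
      eCdes w i + (z i - 𝟙 (isLast i) * sumℚ z)
        ≡⟨ cong (λ s → eCdes w i + (z i - 𝟙 (isLast i) * s)) sumℚ-z ⟩
      eCdes w i + ((x i - eCdes w i) - 𝟙 (isLast i) * 0ℚ)
        ≡⟨ restore (eCdes w i) (x i) (𝟙 (isLast i)) ⟩
      x i ∎
      where
      open ≡-Reasoning
      q q′ : Fin (suc (suc m))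
      q  = w ⟨$⟩ˡ i
      q′ = w ⟨$⟩ˡ cycSuc i
      cancel : ∀ D A B Z → D * 1ℚ + ((A - Z + 1ℚ) - (B - Z + 1ℚ)) ≡ D + (A - B)
      cancel = solve-∀ ℚ-ring
      restore : ∀ D X E → D + ((X - D) - E * 0ℚ) ≡ X
      restore = solve-∀ ℚ-ring

  facets⇒InSimplex : ∀ x → sumℚ x ≡ toℚ (count (cdes w)) →
    (∀ a → FacetIneq w a (next w a) x) → InSimplex w x
  facets⇒InSimplex x Σx≡C facets =
      slack w x , (λ a → p≤q⇒0≤q-p (facets a))
    , sumℚ-slack x Σx≡Σd , λ i → sym (vertexCombination-slack x Σx≡Σd i)
    where
    Σx≡Σd : sumℚ x ≡ sumℚ (eCdes w)
    Σx≡Σd = trans Σx≡C (count≡sumℚ (cdes w))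

  simplex-description : ∀ {k} → count (cdes w) ≡ suc k → ∀ x →
    (InSimplex w x → Eqn k x × (∀ a b → Precedes w a b → FacetIneq w a b x))
    × (Eqn k x × (∀ a b → Precedes w a b → FacetIneq w a b x) → InSimplex w x)
  simplex-description {k} descents x =
      (λ x∈Δ → trans (InSimplex⇒sumℚ w x∈Δ) C≡K
             , precedes-elim w (λ a → proj₁ (interval-bounds w a (next w a) x x∈Δ)))
    , λ (Σx≡K , facets) → facets⇒InSimplex x (trans Σx≡K (sym C≡K)) (λ a → facets a (next w a) refl)
    where
    C≡K : toℚ (count (cdes w)) ≡ toℚ (suc k)
    C≡K = cong toℚ descents

  facet-irredundant : ∀ {k} → count (cdes w) ≡ suc k → ∀ a₀ → ∃ λ x → Eqn k x
    × (∀ a b → Precedes w a b → a ≢ a₀ → FacetIneq w a b x) × ¬ FacetIneq w a₀ (next w a₀) x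
  facet-irredundant descents a₀ = x , trans Σx≡C (cong toℚ descents) , precedes-elim w facets , violated
    where
    b₀ : Fin (suc (suc m))
    b₀ = next w a₀
    C : ℚ
    C = toℚ (count (cdes w))
    x : Fin (suc (suc m)) → ℚ
    x i = eI w b₀ i + eI w b₀ i - eI w a₀ i
    L : Fin (suc (suc m)) → ℚ
    L a = toℚ (cardI∩ w (next w a) a (next w a))
    d : Fin (suc (suc m)) → Fin (suc (suc m)) → ℚ
    d c a = δ (w ⟨$⟩ˡ c) (w ⟨$⟩ˡ a)

    Σx≡C : sumℚ x ≡ C
    Σx≡C = begin
      sumℚ x
        ≡⟨ sumℚ-- (λ i → eI w b₀ i + eI w b₀ i) (eI w a₀) ⟩
      sumℚ (λ i → eI w b₀ i + eI w b₀ i) - sumℚ (eI w a₀)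
        ≡⟨ cong (_- sumℚ (eI w a₀)) (sumℚ-+ (eI w b₀) (eI w b₀)) ⟩
      sumℚ (eI w b₀) + sumℚ (eI w b₀) - sumℚ (eI w a₀)
        ≡⟨ cong₂ (λ u v → u + u - v) (sumℚ-eI w b₀) (sumℚ-eI w a₀) ⟩
      C + C - C
        ≡⟨ cancel C ⟩
      C ∎
      where
      open ≡-Reasoning
      cancel : ∀ C → C + C - C ≡ C
      cancel = solve-∀ ℚ-ring

    xInt-x : ∀ a → xInt a (next w a) x ≡ L a + (d b₀ a + d b₀ a - d a₀ a)
    xInt-x a = begin
      xInt a (next w a) x
        ≡⟨ xInt-- a (next w a) (λ i → eI w b₀ i + eI w b₀ i) (eI w a₀) ⟩
      xInt a (next w a) (λ i → eI w b₀ i + eI w b₀ i) - xInt a (next w a) (eI w a₀)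
        ≡⟨ cong (_- xInt a (next w a) (eI w a₀)) (xInt-+ a (next w a) (eI w b₀) (eI w b₀)) ⟩
      xInt a (next w a) (eI w b₀) + xInt a (next w a) (eI w b₀) - xInt a (next w a) (eI w a₀)
        ≡⟨ cong₂ (λ u v → u + u - v) (xInt-next-eI b₀ a) (xInt-next-eI a₀ a) ⟩
      (L a + d b₀ a) + (L a + d b₀ a) - (L a + d a₀ a)
        ≡⟨ regroup (L a) (d b₀ a) (d a₀ a) ⟩
      L a + (d b₀ a + d b₀ a - d a₀ a) ∎
      where
      open ≡-Reasoning
      regroup : ∀ L B A → (L + B) + (L + B) - (L + A) ≡ L + (B + B - A)
      regroup = solve-∀ ℚ-ring

    facets : ∀ a → a ≢ a₀ → FacetIneq w a (next w a) x
    facets a a≢a₀ = subst (L a ≤_) (sym (xInt-x a)) (p≤p+q (L a) (begin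
      0ℚ                             ≤⟨ +-mono-≤ 0≤d 0≤d ⟩
      d b₀ a + d b₀ a                ≡⟨ +-identityʳ (d b₀ a + d b₀ a) ⟨
      d b₀ a + d b₀ a + 0ℚ           ≡⟨ cong (λ u → d b₀ a + d b₀ a - u) (δ-≢ a₀≢a) ⟨
      d b₀ a + d b₀ a - d a₀ a       ∎))
      where
      open ≤-Reasoning
      0≤d : 0ℚ ≤ d b₀ a
      0≤d = δ-nonneg (w ⟨$⟩ˡ b₀) (w ⟨$⟩ˡ a)
      a₀≢a : w ⟨$⟩ˡ a₀ ≢ w ⟨$⟩ˡ a
      a₀≢a e = a≢a₀ (trans (sym (inverseʳ w)) (trans (cong (w ⟨$⟩ʳ_) (sym e)) (inverseʳ w)))

    violated : ¬ FacetIneq w a₀ (next w a₀) x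
    violated L≤x = <-irrefl refl (<-≤-trans (p-1<p (L a₀)) (subst (L a₀ ≤_) (xInt-at-a₀) L≤x))
      where
      xInt-at-a₀ : xInt a₀ b₀ x ≡ L a₀ - 1ℚ
      xInt-at-a₀ = trans (xInt-x a₀)
        (trans (cong₂ (λ u v → L a₀ + (u + u - v)) (δ-next a₀) (δ-refl (w ⟨$⟩ˡ a₀))) (simplify (L a₀)))
        where
        simplify : ∀ L → L + (0ℚ + 0ℚ - 1ℚ) ≡ L - 1ℚ
        simplify = solve-∀ ℚ-ring

count-cdes-one-letter : (w : Permutation′ 1) → count (cdes w) ≡ 0
count-cdes-one-letter w rewrite <ᵇ-false (ℕ.≤-refl {pos w zero}) = refl

corollary3p4 : (n k : ℕ) (w : Permutation′ n) → InD k n w →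
    -- (1) the bounds on x_{[a,b-1]}
    (∀ (a b : Fin n) → a ≢ b → ∀ (x : Fin n → ℚ) → InSimplex w x →
      (toℚ (cardI∩ w b a b) ≤ xInt a b x) × (xInt a b x ≤ toℚ (cardI∩ w a a b)))
    ×
    -- (2a) Δ_(w) = { x | x_{[n]} = k+1, facet inequalities for a → b in (w) }
    ((∀ (x : Fin n → ℚ) →
        (InSimplex w x → Eqn k x × (∀ a b → Precedes w a b → FacetIneq w a b x))
        × (Eqn k x × (∀ a b → Precedes w a b → FacetIneq w a b x) → InSimplex w x))
    ×
    -- (2b) minimality: no facet inequality is redundant
     ((∀ (a₀ b₀ : Fin n) → Precedes w a₀ b₀ →
        ∃ λ (x : Fin n → ℚ) → Eqn k x
          × (∀ a b → Precedes w a b → a ≢ a₀ → FacetIneq w a b x)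
          × ¬ FacetIneq w a₀ b₀ x)
    ×
    -- (2c) minimality: the equation is not redundant
      (∃ λ (x : Fin n → ℚ) →
          (∀ a b → Precedes w a b → FacetIneq w a b x) × ¬ Eqn k x)))
corollary3p4 zero          k w (_ , ())
corollary3p4 (suc zero)    k w (_ , descents) =
  contradiction (trans (sym (count-cdes-one-letter w)) descents) λ ()
corollary3p4 (suc (suc m)) k w (_ , descents) =
    (λ a b _ → interval-bounds w a b)
  , simplex-description w descents
  , precedes-elim w (facet-irredundant w descents)
  , equation-irredundant w descents zero
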